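{- Let $Q'\subseteq Q$ be the $\mathbb Z$-span of $\{m(\alpha)\alpha:\alpha\in\Phi\}$. Then: (1) For all $1\le i,j\le r$, $\dfrac{2m(\alpha_i)(\alpha_i,\alpha_j)}{m(\alpha_j)(\alpha_j,\alpha_j)}\in\mathbb Z$. (2) The lattice $Q_1=\mathrm{span}_{\mathbb Z}\{m(\alpha_i)\alpha_i:1\le i\le r\}$ is $W$-invariant; hence $Q'=Q_1$. (3) For every $\beta\in Q'$ and every $1\le i\le r$, $\beta(h_i)\in m(\alpha_i)\mathbb Z$.
   Context: Let $A=(a_{ij})_{i,j=1}^r$ be a symmetrizable generalized Cartan matrix with a fixed decomposition $A=\mathrm{diag}(\epsilon_1,\dots,\epsilon_r)B$, where the $\epsilon_i$ are positive rationals and $B=(b_{ij})$ is symmetric with $b_{ii}\in\mathbb Z$ and $b_{ij}\in\frac12\mathbb Z$. Let $(\mathfrak h,\{\alpha_1,\dots,\alpha_r\},\{h_1,\dots,h_r\})$ be a realization of $A$ (so $\alpha_j(h_i)=a_{ij}$), $\Phi$ the set of roots of the Kac–Moody algebra $\mathfrak g(A)$, $\Phi^{\mathrm{re}}$ and $\Phi^{\mathrm{im}}$ the real and imaginary roots, and $(\cdot,\cdot)$ the standard symmetric bilinear form on $\mathfrak h^*$ with $(\alpha_i,\alpha_j)=b_{ij}$. Let $Q=\bigoplus_i\mathbb Z\alpha_i$ and $W$ the Weyl group generated by the simple reflections $\sigma_i$. Fix an integer $n\ge1$ and set $m(\alpha)=n/\gcd(n,(\alpha,\alpha))$ for $\alpha\in\Phi^{\mathrm{re}}$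 and $m(\alpha)=n$ for $\alpha\in\Phi^{\mathrm{im}}$. -}

module Defs where

open import Data.Nat as ℕ using (ℕ; zero; suc; NonZero; ≢-nonZero; ≢-nonZero⁻¹)
open import Data.Nat.GCD using (gcd; gcd[m,n]≢0)
open import Data.Integer as ℤ using (ℤ; +_; _+_; _-_; _*_; -_; ∣_∣; _≤_; _<_)
open import Data.Integer.DivMod as ℤD using ()
open import Data.Rational as ℚ using (ℚ; Positive)
open import Data.Fin using (Fin; zero; suc)
open import Data.Fin as Fin using ()
open import Data.Bool using (Bool; true; false; if_then_else_)
open import Data.List using (List; []; _∷_; foldr)
open import Data.List.Relation.Unary.All using (All)
open import Data.Product using (Σ; ∃; ∃-syntax; _×_; _,_; proj₁; proj₂)
open import Data.Sum using (_⊎_; inj₁)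
open import Relation.Nullary using (¬_; does)
open import Relation.Binary.PropositionalEquality using (_≡_; _≢_)

-- We store B through the integer matrix
-- B2 = 2B (so b_ij ∈ ½ℤ ⇔ B2 i j ∈ ℤ, and b_ii ∈ ℤ ⇔ B2 i i even).

toℚ : ℤ → ℚ
toℚ z = z ℚ./ 1

record SymGCM (r : ℕ) : Set where
  field
    A     : Fin r → Fin r → ℤ
    ε     : Fin r → ℚ
    B2    : Fin r → Fin r → ℤ
    A-diag   : ∀ i → A i i ≡ + 2
    A-offdiag : ∀ i j → i ≢ j → A i j ≤ + 0
    A-zero   : ∀ i j → A i j ≡ + 0 → A j i ≡ + 0
    ε-pos    : ∀ i → Positive (ε i)
    B-sym    : ∀ i j → B2 i j ≡ B2 j i
    B-diag   : ∀ i → ∃[ z ] B2 i i ≡ + 2 * z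
    A≡εB     : ∀ i j → toℚ (A i j) ≡ ε i ℚ.* (B2 i j ℚ./ 2)

-- The root lattice Q = ⊕ ℤ αᵢ, elements as coordinate vectors.

Lat : ℕ → Set
Lat r = Fin r → ℤ

_≈_ : ∀ {r} → Lat r → Lat r → Set
β ≈ γ = ∀ j → β j ≡ γ j

∑ : ∀ {r} → (Fin r → ℤ) → ℤ
∑ {zero}  f = + 0
∑ {suc r} f = f zero + ∑ (λ j → f (suc j))

0L : ∀ {r} → Lat r
0L _ = + 0

_⊕_ : ∀ {r} → Lat r → Lat r → Lat r
(β ⊕ γ) j = β j + γ j

_·_ : ∀ {r} → ℤ → Lat r → Lat r
(z · β) j = z * β j

negL : ∀ {r} → Lat r → Lat r
negL β j = - β j

α : ∀ {r} → Fin r → Lat r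
α i j = if does (i Fin.≟ j) then + 1 else + 0

module _ {r : ℕ} (D : SymGCM r) where
  open SymGCM D

  -- β(hᵢ) = Σ_j k_j a_ij  for β = Σ_j k_j α_j
  ev : Lat r → Fin r → ℤ
  ev β i = ∑ (λ j → β j * A i j)

  σ : Fin r → Lat r → Lat r
  σ i β = β ⊕ ((- ev β i) · α i)

  -- Weyl group elements as words in the simple reflections:
  -- act (i₁ ∷ … ∷ iₖ) = σ_{i₁} ∘ … ∘ σ_{iₖ}
  act : List (Fin r) → Lat r → Lat r
  act w β = foldr σ β w

  -- twice the standard form:  form2 β γ = 2 (β, γ)
  form2 : Lat r → Lat r → ℤ
  form2 β γ = ∑ (λ i → ∑ (λ j → β i * γ j * B2 i j))

  -- (β, β)  (an integer, since B2 has even diagonal and is symmetric)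
  normSq : Lat r → ℤ
  normSq β = form2 β β ℤD./ (+ 2)

  -- support of β ∈ Q₊ is connected in the Dynkin diagram of A:
  -- no splitting of the support into two nonempty parts without an edge
  ConnectedSupport : Lat r → Set
  ConnectedSupport β =
    (S : Fin r → Bool) →
    (∀ i → S i ≡ true → + 0 < β i) →
    (∃[ i ] S i ≡ true) →
    (∃[ j ] (S j ≡ false × + 0 < β j)) →
    ∃[ i ] ∃[ j ] (S i ≡ true × S j ≡ false × + 0 < β j × A i j ≢ + 0)

  InK : Lat r → Set
  InK β = (∀ i → + 0 ≤ β i) × (∃[ i ] + 0 < β i)
        × (∀ i → ev β i ≤ + 0) × ConnectedSupport β

  IsReal : Lat r → Set
  IsReal β = ∃[ w ] ∃[ i ] act w (α i) ≈ β

  -- imaginary roots: W(K) ∪ −W(K)   (Kac, Thm. 5.4)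
  IsImag : Lat r → Set
  IsImag β = ∃[ w ] ∃[ k ] (InK k × (act w k ≈ β ⊎ negL (act w k) ≈ β))

  IsRoot : Lat r → Set
  IsRoot β = IsReal β ⊎ IsImag β

  module _ (n : ℕ) .{{n≢0 : NonZero n}} where

    mRe : Lat r → ℕ
    mRe β = ℕ._/_ n (gcd n ∣ normSq β ∣)
              {{≢-nonZero (gcd[m,n]≢0 n ∣ normSq β ∣ (inj₁ (≢-nonZero⁻¹ n)))}}

    m : Fin r → ℕ
    m i = mRe (α i)

    GenQ' : Lat r → Set
    GenQ' γ = ∃[ β ] ((IsReal β × γ ≈ ((+ mRe β) · β))
                    ⊎ (IsImag β × γ ≈ ((+ n) · β)))

    GenQ₁ : Lat r → Set
    GenQ₁ γ = ∃[ i ] γ ≈ ((+ m i) · α i)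

lincomb : ∀ {r} → List (ℤ × Lat r) → Lat r
lincomb = foldr (λ p acc → (proj₁ p · proj₂ p) ⊕ acc) 0L

Span : ∀ {r} → (Lat r → Set) → Lat r → Set
Span {r} P β = ∃[ L ] (All (λ p → P (proj₂ p)) L × β ≈ lincomb {r} L)

-- Write m(t) = n / gcd(n, t), the additive order of t modulo n.  The normalisation A = diag(ε) B
-- gives 2bᵢⱼ = aᵢⱼ bᵢᵢ, so by symmetry of B, aᵢⱼ bᵢᵢ = aⱼᵢ bⱼⱼ.  As n divides m(bᵢᵢ) bᵢᵢ, it
-- divides m(bᵢᵢ) aⱼᵢ bⱼⱼ, whence m(αⱼ) ∣ m(αᵢ) aⱼᵢ, which is (1).  Consequently for β ∈ Q₁ every
-- summand of β(hᵢ) = Σⱼ βⱼ aᵢⱼ lies in m(αᵢ)ℤ, so σᵢ β = β − β(hᵢ) αᵢ stays in Q₁.  W preserves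
-- (·,·), so a real root β = w αᵢ has m(β) = m(αᵢ) and m(β) β = w (m(αᵢ) αᵢ) ∈ Q₁, while m(αⱼ) ∣ n
-- puts n β in Q₁ for every β.  Hence Q' = Q₁, and (3) is the statement about β(hᵢ) above.
{-# OPTIONS --safe #-}
module Submission where

open import Defs
open import Data.Nat as ℕ using (ℕ; NonZero; ≢-nonZero; ≢-nonZero⁻¹)
import Data.Nat.Properties as ℕP
import Data.Nat.DivMod as ℕD
import Data.Nat.Divisibility as ℕ∣
open import Data.Nat.GCD using (gcd; gcd[m,n]≢0; gcd[m,n]∣m; gcd[m,n]∣n; gcd-greatest; c*gcd[m,n]≡gcd[cm,cn])
open import Data.Integer as ℤ using (ℤ; +_; -[1+_]; _+_; _*_; -_; ∣_∣)
open import Data.Integer.Properties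
import Data.Integer.DivMod as ℤD
open import Data.Integer.Divisibility.Signed using (_∣_; divides; ∣ᵤ⇒∣; ∣-trans; ∣m∣n⇒∣m+n; ∣m⇒∣-m; ∣n⇒∣m*n; ∣m⇒∣m*n; *-monoˡ-∣)
open import Data.Integer.Tactic.RingSolver using (solve-∀)
import Data.Nat.Tactic.RingSolver as ℕRing
import Data.Rational as ℚ
import Data.Rational.Properties as ℚP
open import Data.Rational.Unnormalised as ℚᵘ using (mkℚᵘ)
import Data.Rational.Unnormalised.Properties as ℚᵘP
open import Data.Fin as Fin using (Fin; zero; suc)
open import Data.List using (List; []; _∷_; tabulate)
open import Data.List.Relation.Unary.All as All using (All; []; _∷_)
open import Data.List.Relation.Unary.All.Properties using (tabulate⁺)
open import Data.Sum using (inj₁; inj₂)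
open import Data.Product using (∃-syntax; _×_; _,_; proj₁; proj₂)
open import Relation.Binary.PropositionalEquality
open import Relation.Nullary using (yes; no)
open import Function.Bundles using (_⇔_; mk⇔)

∑-cong : ∀ {r} {f g : Fin r → ℤ} → (∀ j → f j ≡ g j) → ∑ f ≡ ∑ g
∑-cong {ℕ.zero}  f≡g = refl
∑-cong {ℕ.suc r} f≡g = cong₂ _+_ (f≡g zero) (∑-cong (λ j → f≡g (suc j)))

∑-zero : ∀ {r} → ∑ {r} (λ _ → + 0) ≡ + 0
∑-zero {ℕ.zero}  = refl
∑-zero {ℕ.suc r} = trans (+-identityˡ _) (∑-zero {r})

∑-+ : ∀ {r} (f g : Fin r → ℤ) → ∑ (λ j → f j + g j) ≡ ∑ f + ∑ g
∑-+ {ℕ.zero}  f g = refl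
∑-+ {ℕ.suc r} f g = trans (cong (_+_ (f zero + g zero)) (∑-+ (λ j → f (suc j)) (λ j → g (suc j))))
                          (interchange (f zero) (g zero) _ _)
  where
  interchange : ∀ a b c d → (a + b) + (c + d) ≡ (a + c) + (b + d)
  interchange = solve-∀

∑-* : ∀ {r} (c : ℤ) (f : Fin r → ℤ) → ∑ (λ j → c * f j) ≡ c * ∑ f
∑-* {ℕ.zero}  c f = sym (*-zeroʳ c)
∑-* {ℕ.suc r} c f = trans (cong (_+_ (c * f zero)) (∑-* c (λ j → f (suc j))))
                          (sym (*-distribˡ-+ c _ _))

∑-linear : ∀ {r} (c : ℤ) (f g : Fin r → ℤ) → ∑ (λ j → f j + c * g j) ≡ ∑ f + c * ∑ g
∑-linear c f g = trans (∑-+ f (λ j → c * g j)) (cong (_+_ (∑ f)) (∑-* c g))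

∑-swap : ∀ {r s} (f : Fin r → Fin s → ℤ) → ∑ (λ i → ∑ (λ j → f i j)) ≡ ∑ (λ j → ∑ (λ i → f i j))
∑-swap {ℕ.zero} {s} f = sym (∑-zero {s})
∑-swap {ℕ.suc r} f = trans (cong (_+_ (∑ (f zero))) (∑-swap (λ i → f (suc i))))
                           (sym (∑-+ (f zero) (λ j → ∑ (λ i → f (suc i) j))))

∑-∣ : ∀ {r} {k : ℤ} {f : Fin r → ℤ} → (∀ j → k ∣ f j) → k ∣ ∑ f
∑-∣ {ℕ.zero}  {k} k∣f = divides (+ 0) (sym (*-zeroˡ k))
∑-∣ {ℕ.suc r} k∣f = ∣m∣n⇒∣m+n (k∣f zero) (∑-∣ (λ j → k∣f (suc j)))

α-sym : ∀ {r} (i j : Fin r) → α i j ≡ α j i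
α-sym zero    zero    = refl
α-sym zero    (suc j) = refl
α-sym (suc i) zero    = refl
α-sym (suc i) (suc j) = α-sym i j

∑-α : ∀ {r} (i : Fin r) (f : Fin r → ℤ) → ∑ (λ j → α i j * f j) ≡ f i
∑-α {ℕ.suc r} zero f = trans (cong₂ _+_ (*-identityˡ (f zero))
                                 (trans (∑-cong (λ j → *-zeroˡ (f (suc j)))) (∑-zero {r})))
                      (+-identityʳ (f zero))
∑-α (suc i) f = trans (cong₂ _+_ (*-zeroˡ (f zero)) (∑-α i (λ j → f (suc j))))
                      (+-identityˡ _)

[2*z]/2≡z : ∀ z → (+ 2 * z) ℤ./ + 2 ≡ z
[2*z]/2≡z (+ k) = begin
  + 2 * + k ℤ./ + 2   ≡⟨ cong (ℤ._/ + 2) (sym (pos-* 2 k)) ⟩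
  + (2 ℕ.* k) ℤ./ + 2 ≡⟨ ℤD.div-pos-is-/ℕ (+ (2 ℕ.* k)) 2 ⟩
  + ((2 ℕ.* k) ℕ./ 2) ≡⟨ cong (λ x → + (x ℕ./ 2)) (ℕP.*-comm 2 k) ⟩
  + ((k ℕ.* 2) ℕ./ 2) ≡⟨ cong +_ (ℕD.m*n/n≡m k 2) ⟩
  + k                 ∎
  where open ≡-Reasoning
[2*z]/2≡z -[1+ k ] = trans (ℤD.div-pos-is-/ℕ (+ 2 * -[1+ k ]) 2) (negative _ (double-suc k))
  where
  double-suc : ∀ k → ℕ.suc (k ℕ.+ 1 ℕ.* ℕ.suc k) ≡ ℕ.suc k ℕ.* 2
  double-suc = ℕRing.solve-∀
  negative : ∀ N → ℕ.suc N ≡ ℕ.suc k ℕ.* 2 → -[1+ N ] ℤ./ℕ 2 ≡ -[1+ k ]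
  negative N eq with ℕ.suc N ℕ.% 2 in rem
  ... | ℕ.zero  = cong (λ x → - (+ x)) (trans (cong (ℕ._/ 2) eq) (ℕD.m*n/n≡m (ℕ.suc k) 2))
  ... | ℕ.suc _ with () ← trans (sym rem) (trans (cong (ℕ._% 2) eq) (ℕD.m*n%n≡0 (ℕ.suc k) 2))

module AdditiveOrder (n : ℕ) .{{n≢0 : NonZero n}} where

  private instance
    gcd≢0 : ∀ {t} → NonZero (gcd n t)
    gcd≢0 {t} = ≢-nonZero (gcd[m,n]≢0 n t (inj₁ (≢-nonZero⁻¹ n)))

  ord : ℕ → ℕ
  ord t = n ℕ./ gcd n t

  ord∣n : ∀ t → ord t ℕ∣.∣ n
  ord∣n t = ℕ∣.m/n∣m (gcd[m,n]∣m n t)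

  n∣ord*t : ∀ t → n ℕ∣.∣ ord t ℕ.* t
  n∣ord*t t = subst (ℕ∣._∣ ord t ℕ.* t) (ℕD.m/n*n≡m (gcd[m,n]∣m n t))
                    (ℕ∣.*-monoʳ-∣ (ord t) (gcd[m,n]∣n n t))

  n∣c*t⇒ord∣c : ∀ {c t} → n ℕ∣.∣ c ℕ.* t → ord t ℕ∣.∣ c
  n∣c*t⇒ord∣c {c} {t} n∣ct = ℕ∣.m∣n*o⇒m/n∣o (gcd[m,n]∣m n t) n∣c*gcd
    where
    n∣c*gcd : n ℕ∣.∣ c ℕ.* gcd n t
    n∣c*gcd = subst (n ℕ∣.∣_) (sym (c*gcd[m,n]≡gcd[cm,cn] c n t))
                    (gcd-greatest (ℕ∣.n∣m*n c) n∣ct)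

  -- n divides ord(|s|) |x| |s| = ord(|s|) |y| |t|.
  ord-∣-transfer : ∀ {s t x y} → x * s ≡ y * t → + ord (∣ t ∣) ∣ + ord (∣ s ∣) * y
  ord-∣-transfer {s} {t} {x} {y} xs≡yt =
    ∣ᵤ⇒∣ (subst (ord ∣ t ∣ ℕ∣.∣_) (sym (abs-* (+ ord ∣ s ∣) y)) (n∣c*t⇒ord∣c n∣ord*y*t))
    where
    open ≡-Reasoning
    left-comm : ∀ a b c → a ℕ.* (b ℕ.* c) ≡ b ℕ.* (a ℕ.* c)
    left-comm = ℕRing.solve-∀
    rearrange : ord ∣ s ∣ ℕ.* ∣ y ∣ ℕ.* ∣ t ∣ ≡ ∣ x ∣ ℕ.* (ord ∣ s ∣ ℕ.* ∣ s ∣)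
    rearrange = begin
      ord ∣ s ∣ ℕ.* ∣ y ∣ ℕ.* ∣ t ∣   ≡⟨ ℕP.*-assoc (ord ∣ s ∣) ∣ y ∣ ∣ t ∣ ⟩
      ord ∣ s ∣ ℕ.* (∣ y ∣ ℕ.* ∣ t ∣) ≡⟨ cong (ord ∣ s ∣ ℕ.*_) (sym (abs-* y t)) ⟩
      ord ∣ s ∣ ℕ.* ∣ y * t ∣         ≡⟨ cong (λ z → ord ∣ s ∣ ℕ.* ∣ z ∣) (sym xs≡yt) ⟩
      ord ∣ s ∣ ℕ.* ∣ x * s ∣         ≡⟨ cong (ord ∣ s ∣ ℕ.*_) (abs-* x s) ⟩
      ord ∣ s ∣ ℕ.* (∣ x ∣ ℕ.* ∣ s ∣) ≡⟨ left-comm (ord ∣ s ∣) ∣ x ∣ ∣ s ∣ ⟩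
      ∣ x ∣ ℕ.* (ord ∣ s ∣ ℕ.* ∣ s ∣) ∎
    n∣ord*y*t : n ℕ∣.∣ ord ∣ s ∣ ℕ.* ∣ y ∣ ℕ.* ∣ t ∣
    n∣ord*y*t = subst (n ℕ∣.∣_) (sym rearrange) (ℕ∣.∣n⇒∣m*n ∣ x ∣ (n∣ord*t ∣ s ∣))


module _ {r} (D : SymGCM r) where
  open SymGCM D

  A≃ε*B2/2 : ∀ i j → mkℚᵘ (A i j) 0 ℚᵘ.≃ ℚ.toℚᵘ (ε i) ℚᵘ.* mkℚᵘ (B2 i j) 1
  A≃ε*B2/2 i j = begin
    mkℚᵘ (A i j) 0                              ≈⟨ ℚᵘP.≃-sym (ℚP.toℚᵘ-fromℚᵘ (mkℚᵘ (A i j) 0)) ⟩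
    ℚ.toℚᵘ (toℚ (A i j))                        ≡⟨ cong ℚ.toℚᵘ (A≡εB i j) ⟩
    ℚ.toℚᵘ (ε i ℚ.* (B2 i j ℚ./ 2))             ≈⟨ ℚP.toℚᵘ-homo-* (ε i) _ ⟩
    ℚ.toℚᵘ (ε i) ℚᵘ.* ℚ.toℚᵘ (B2 i j ℚ./ 2)     ≈⟨ ℚᵘP.*-congˡ {ℚ.toℚᵘ (ε i)} (ℚP.toℚᵘ-fromℚᵘ (mkℚᵘ (B2 i j) 1)) ⟩
    ℚ.toℚᵘ (ε i) ℚᵘ.* mkℚᵘ (B2 i j) 1           ∎
    where open ℚᵘP.≃-Reasoning

  -- aᵢₖ and aᵢᵢ = 2 are εᵢ times bᵢₖ and bᵢᵢ, so the factor εᵢ cancels.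
  A*B2ᵢᵢ≡2*B2 : ∀ i k → A i k * B2 i i ≡ + 2 * B2 i k
  A*B2ᵢᵢ≡2*B2 i k = trans (*-cancelʳ-≡ _ _ (+ 2) (ℚᵘP.drop-*≡* cross-multiplied))
                          (trans (cong (B2 i k *_) (A-diag i)) (*-comm (B2 i k) (+ 2)))
    where
    open ℚᵘP.≃-Reasoning
    E = ℚ.toℚᵘ (ε i)
    Y = mkℚᵘ (B2 i k) 1
    Z = mkℚᵘ (B2 i i) 1
    cross-multiplied : mkℚᵘ (A i k) 0 ℚᵘ.* Z ℚᵘ.≃ Y ℚᵘ.* mkℚᵘ (A i i) 0
    cross-multiplied = begin
      mkℚᵘ (A i k) 0 ℚᵘ.* Z  ≈⟨ ℚᵘP.*-congʳ (A≃ε*B2/2 i k) ⟩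
      (E ℚᵘ.* Y) ℚᵘ.* Z      ≈⟨ ℚᵘP.*-congʳ (ℚᵘP.*-comm E Y) ⟩
      (Y ℚᵘ.* E) ℚᵘ.* Z      ≈⟨ ℚᵘP.*-assoc Y E Z ⟩
      Y ℚᵘ.* (E ℚᵘ.* Z)      ≈⟨ ℚᵘP.*-congˡ {Y} (ℚᵘP.≃-sym (A≃ε*B2/2 i i)) ⟩
      Y ℚᵘ.* mkℚᵘ (A i i) 0  ∎

  bᵢᵢ : Fin r → ℤ
  bᵢᵢ i = proj₁ (B-diag i)

  B2≡A*bᵢᵢ : ∀ i k → B2 i k ≡ A i k * bᵢᵢ i
  B2≡A*bᵢᵢ i k = *-cancelˡ-≡ (+ 2) _ _ (begin
    + 2 * B2 i k          ≡⟨ sym (A*B2ᵢᵢ≡2*B2 i k) ⟩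
    A i k * B2 i i        ≡⟨ cong (A i k *_) (proj₂ (B-diag i)) ⟩
    A i k * (+ 2 * bᵢᵢ i) ≡⟨ left-comm (A i k) (+ 2) (bᵢᵢ i) ⟩
    + 2 * (A i k * bᵢᵢ i) ∎)
    where
    open ≡-Reasoning
    left-comm : ∀ a b c → a * (b * c) ≡ b * (a * c)
    left-comm = solve-∀

  ev-cong : ∀ {β γ} → β ≈ γ → ∀ i → ev D β i ≡ ev D γ i
  ev-cong β≈γ i = ∑-cong (λ j → cong (_* A i j) (β≈γ j))

  ev-linear : ∀ β c γ i → ev D (β ⊕ (c · γ)) i ≡ ev D β i + c * ev D γ i
  ev-linear β c γ i = trans (∑-cong (λ j → distrib (β j) c (γ j) (A i j)))
                            (∑-linear c (λ j → β j * A i j) (λ j → γ j * A i j))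
    where
    distrib : ∀ x c y a → (x + c * y) * a ≡ x * a + c * (y * a)
    distrib = solve-∀

  ev-· : ∀ c β i → ev D (c · β) i ≡ c * ev D β i
  ev-· c β i = trans (∑-cong (λ j → *-assoc c (β j) (A i j))) (∑-* c (λ j → β j * A i j))

  ev-α-self : ∀ i → ev D (α i) i ≡ + 2
  ev-α-self i = trans (∑-α i (A i)) (A-diag i)

  ev-σ-self : ∀ i β → ev D (σ D i β) i ≡ - ev D β i
  ev-σ-self i β = begin
    ev D (σ D i β) i                          ≡⟨ ev-linear β (- ev D β i) (α i) i ⟩
    ev D β i + - ev D β i * ev D (α i) i      ≡⟨ cong (λ x → ev D β i + - ev D β i * x) (ev-α-self i) ⟩
    ev D β i + - ev D β i * + 2               ≡⟨ reflect (ev D β i) ⟩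
    - ev D β i                                ∎
    where
    open ≡-Reasoning
    reflect : ∀ e → e + - e * + 2 ≡ - e
    reflect = solve-∀

  σ-cong : ∀ i {β γ} → β ≈ γ → σ D i β ≈ σ D i γ
  σ-cong i β≈γ j = cong₂ (λ x e → x + - e * α i j) (β≈γ j) (ev-cong β≈γ i)

  σ-· : ∀ i c β → σ D i (c · β) ≈ (c · σ D i β)
  σ-· i c β j = trans (cong (λ e → c * β j + - e * α i j) (ev-· c β i))
                      (distrib c (β j) (ev D β i) (α i j))
    where
    distrib : ∀ c b e a → c * b + - (c * e) * a ≡ c * (b + - e * a)
    distrib = solve-∀

  act-· : ∀ w c β → act D w (c · β) ≈ (c · act D w β)
  act-· []      c β j = refl
  act-· (i ∷ w) c β j = trans (σ-cong i (act-· w c β) j) (σ-· i c (act D w β) j)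

  form2-cong : ∀ {β β' γ γ'} → β ≈ β' → γ ≈ γ' → form2 D β γ ≡ form2 D β' γ'
  form2-cong β≈β' γ≈γ' =
    ∑-cong (λ a → ∑-cong (λ b → cong₂ (λ x y → x * y * B2 a b) (β≈β' a) (γ≈γ' b)))

  form2-linearˡ : ∀ β c γ δ → form2 D (β ⊕ (c · γ)) δ ≡ form2 D β δ + c * form2 D γ δ
  form2-linearˡ β c γ δ = begin
    ∑ (λ a → ∑ (λ b → (β a + c * γ a) * δ b * B2 a b))
      ≡⟨ ∑-cong (λ a → ∑-cong (λ b → distrib (β a) c (γ a) (δ b) (B2 a b))) ⟩
    ∑ (λ a → ∑ (λ b → β a * δ b * B2 a b + c * (γ a * δ b * B2 a b)))
      ≡⟨ ∑-cong (λ a → ∑-linear c (λ b → β a * δ b * B2 a b) (λ b → γ a * δ b * B2 a b)) ⟩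
    ∑ (λ a → ∑ (λ b → β a * δ b * B2 a b) + c * ∑ (λ b → γ a * δ b * B2 a b))
      ≡⟨ ∑-linear c (λ a → ∑ (λ b → β a * δ b * B2 a b)) (λ a → ∑ (λ b → γ a * δ b * B2 a b)) ⟩
    form2 D β δ + c * form2 D γ δ ∎
    where
    open ≡-Reasoning
    distrib : ∀ x c y z b → (x + c * y) * z * b ≡ x * z * b + c * (y * z * b)
    distrib = solve-∀

  form2-comm : ∀ β γ → form2 D β γ ≡ form2 D γ β
  form2-comm β γ = trans (∑-swap (λ a b → β a * γ b * B2 a b))
    (∑-cong (λ b → ∑-cong (λ a → cong₂ _*_ (*-comm (β a) (γ b)) (B-sym a b))))

  form2-αˡ : ∀ i γ → form2 D (α i) γ ≡ bᵢᵢ i * ev D γ i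
  form2-αˡ i γ = begin
    ∑ (λ a → ∑ (λ b → α i a * γ b * B2 a b))     ≡⟨ ∑-cong (λ a → ∑-cong (λ b → *-assoc (α i a) (γ b) (B2 a b))) ⟩
    ∑ (λ a → ∑ (λ b → α i a * (γ b * B2 a b)))   ≡⟨ ∑-cong (λ a → ∑-* (α i a) (λ b → γ b * B2 a b)) ⟩
    ∑ (λ a → α i a * ∑ (λ b → γ b * B2 a b))     ≡⟨ ∑-α i (λ a → ∑ (λ b → γ b * B2 a b)) ⟩
    ∑ (λ b → γ b * B2 i b)                       ≡⟨ ∑-cong (λ b → trans (cong (γ b *_) (B2≡A*bᵢᵢ i b)) (rearrange (γ b) (A i b) (bᵢᵢ i))) ⟩
    ∑ (λ b → bᵢᵢ i * (γ b * A i b))              ≡⟨ ∑-* (bᵢᵢ i) (λ b → γ b * A i b) ⟩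
    bᵢᵢ i * ev D γ i                             ∎
    where
    open ≡-Reasoning
    rearrange : ∀ x a b → x * (a * b) ≡ b * (x * a)
    rearrange = solve-∀

  form2-σ : ∀ i β → form2 D (σ D i β) (σ D i β) ≡ form2 D β β
  form2-σ i β = begin
    form2 D (σ D i β) (σ D i β)
      ≡⟨ form2-linearˡ β c (α i) (σ D i β) ⟩
    form2 D β (σ D i β) + c * form2 D (α i) (σ D i β)
      ≡⟨ cong₂ (λ x y → x + c * y) (form2-comm β (σ D i β)) (form2-αˡ i (σ D i β)) ⟩
    form2 D (σ D i β) β + c * (b * ev D (σ D i β) i)
      ≡⟨ cong₂ (λ x y → x + c * (b * y)) (form2-linearˡ β c (α i) β) (ev-σ-self i β) ⟩
    form2 D β β + c * form2 D (α i) β + c * (b * - e)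
      ≡⟨ cong (λ x → form2 D β β + c * x + c * (b * - e)) (form2-αˡ i β) ⟩
    form2 D β β + - e * (b * e) + - e * (b * - e)
      ≡⟨ cancel (form2 D β β) b e ⟩
    form2 D β β ∎
    where
    open ≡-Reasoning
    e = ev D β i
    c = - e
    b = bᵢᵢ i
    cancel : ∀ F b e → F + - e * (b * e) + - e * (b * - e) ≡ F
    cancel = solve-∀

  normSq-cong : ∀ {β γ} → β ≈ γ → normSq D β ≡ normSq D γ
  normSq-cong β≈γ = cong (ℤ._/ + 2) (form2-cong β≈γ β≈γ)

  normSq-act : ∀ w β → normSq D (act D w β) ≡ normSq D β
  normSq-act []      β = refl
  normSq-act (i ∷ w) β = trans (cong (ℤ._/ + 2) (form2-σ i (act D w β))) (normSq-act w β)

  normSq-α : ∀ i → normSq D (α i) ≡ bᵢᵢ i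
  normSq-α i = begin
    form2 D (α i) (α i) ℤ./ + 2 ≡⟨ cong (ℤ._/ + 2) (form2-αˡ i (α i)) ⟩
    bᵢᵢ i * ev D (α i) i ℤ./ + 2 ≡⟨ cong (λ x → bᵢᵢ i * x ℤ./ + 2) (ev-α-self i) ⟩
    bᵢᵢ i * + 2 ℤ./ + 2          ≡⟨ cong (ℤ._/ + 2) (*-comm (bᵢᵢ i) (+ 2)) ⟩
    + 2 * bᵢᵢ i ℤ./ + 2          ≡⟨ [2*z]/2≡z (bᵢᵢ i) ⟩
    bᵢᵢ i                        ∎
    where open ≡-Reasoning

module _ {r} (D : SymGCM r) (n : ℕ) .{{_ : NonZero n}} where
  open SymGCM D
  open AdditiveOrder n

  m≡ord : ∀ i → m D n i ≡ ord ∣ bᵢᵢ D i ∣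
  m≡ord i = cong (λ t → ord ∣ t ∣) (normSq-α D i)

  m∣m*A : ∀ i j → + m D n j ∣ + m D n i * A j i
  m∣m*A i j = subst₂ (λ a b → + a ∣ + b * A j i) (sym (m≡ord j)) (sym (m≡ord i))
    (ord-∣-transfer {s = bᵢᵢ D i} {x = A i j} (trans (sym (B2≡A*bᵢᵢ D i j)) (trans (B-sym i j) (B2≡A*bᵢᵢ D j i))))

  m*normSq∣m*B2 : ∀ i j → + m D n j * normSq D (α j) ∣ + m D n i * B2 i j
  m*normSq∣m*B2 i j with m∣m*A i j
  ... | divides z eq = divides z (begin
    + m D n i * B2 i j             ≡⟨ cong (+ m D n i *_) (trans (B-sym i j) (B2≡A*bᵢᵢ D j i)) ⟩
    + m D n i * (A j i * bᵢᵢ D j)  ≡⟨ sym (*-assoc (+ m D n i) (A j i) (bᵢᵢ D j)) ⟩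
    + m D n i * A j i * bᵢᵢ D j    ≡⟨ cong (_* bᵢᵢ D j) eq ⟩
    z * + m D n j * bᵢᵢ D j        ≡⟨ *-assoc z (+ m D n j) (bᵢᵢ D j) ⟩
    z * (+ m D n j * bᵢᵢ D j)      ≡⟨ cong (λ t → z * (+ m D n j * t)) (sym (normSq-α D j)) ⟩
    z * (+ m D n j * normSq D (α j)) ∎)
    where open ≡-Reasoning

  InQ₁ : Lat r → Set
  InQ₁ β = ∀ j → + m D n j ∣ β j

  InQ₁-cong : ∀ {β γ} → β ≈ γ → InQ₁ β → InQ₁ γ
  InQ₁-cong β≈γ β∈Q₁ j = subst (+ m D n j ∣_) (β≈γ j) (β∈Q₁ j)

  ∣⇒∣*α : ∀ i j {x} → + m D n i ∣ x → + m D n j ∣ x * α i j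
  ∣⇒∣*α i j {x} m∣x with i Fin.≟ j
  ... | yes refl = ∣m⇒∣m*n (+ 1) m∣x
  ... | no _     = ∣n⇒∣m*n x (divides (+ 0) refl)

  GenQ₁⇒InQ₁ : ∀ {γ} → GenQ₁ D n γ → InQ₁ γ
  GenQ₁⇒InQ₁ (i , γ≈mα) = InQ₁-cong (λ j → sym (γ≈mα j))
    (λ j → ∣⇒∣*α i j (divides (+ 1) (sym (*-identityˡ _))))

  Span⇒InQ₁ : ∀ {P : Lat r → Set} → (∀ {γ} → P γ → InQ₁ γ) → ∀ {β} → Span P β → InQ₁ β
  Span⇒InQ₁ {P} P⊆Q₁ (L , Ps , β≈L) = InQ₁-cong (λ j → sym (β≈L j)) (lincomb∈Q₁ L Ps)
    where
    lincomb∈Q₁ : ∀ L → All (λ p → P (proj₂ p)) L → InQ₁ (lincomb L)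
    lincomb∈Q₁ []            []       j = divides (+ 0) refl
    lincomb∈Q₁ ((z , γ) ∷ L) (Pγ ∷ Ps) j = ∣m∣n⇒∣m+n (∣n⇒∣m*n z (P⊆Q₁ Pγ j)) (lincomb∈Q₁ L Ps j)

  InQ₁⇒Span : ∀ {β} → InQ₁ β → Span (GenQ₁ D n) β
  InQ₁⇒Span {β} β∈Q₁ = tabulate generator , tabulate⁺ (λ j → j , λ k → refl) , β≈lincomb
    where
    open ≡-Reasoning
    q : Fin r → ℤ
    q j = _∣_.quotient (β∈Q₁ j)
    generator : Fin r → ℤ × Lat r
    generator j = q j , (+ m D n j) · α j
    lincomb-tabulate : ∀ {s} (g : Fin s → ℤ × Lat r) k →
                       lincomb (tabulate g) k ≡ ∑ (λ j → proj₁ (g j) * proj₂ (g j) k)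
    lincomb-tabulate {ℕ.zero}  g k = refl
    lincomb-tabulate {ℕ.suc s} g k = cong (_+_ (proj₁ (g zero) * proj₂ (g zero) k))
                                         (lincomb-tabulate (λ j → g (suc j)) k)
    rearrange : ∀ q m a → q * (m * a) ≡ a * (q * m)
    rearrange = solve-∀
    β≈lincomb : β ≈ lincomb (tabulate generator)
    β≈lincomb k = sym (begin
      lincomb (tabulate generator) k     ≡⟨ lincomb-tabulate generator k ⟩
      ∑ (λ j → q j * (+ m D n j * α j k)) ≡⟨ ∑-cong (λ j → trans (cong (λ a → q j * (+ m D n j * a)) (α-sym j k))
                                                                (rearrange (q j) (+ m D n j) (α k j))) ⟩
      ∑ (λ j → α k j * (q j * + m D n j)) ≡⟨ ∑-α k (λ j → q j * + m D n j) ⟩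
      q k * + m D n k                    ≡⟨ sym (_∣_.equality (β∈Q₁ k)) ⟩
      β k                                ∎)

  ev-InQ₁ : ∀ {β} → InQ₁ β → ∀ i → + m D n i ∣ ev D β i
  ev-InQ₁ {β} β∈Q₁ i = ∑-∣ (λ j → ∣-trans (m∣m*A j i) (*-monoˡ-∣ (A i j) (β∈Q₁ j)))

  σ-InQ₁ : ∀ i {β} → InQ₁ β → InQ₁ (σ D i β)
  σ-InQ₁ i β∈Q₁ j = ∣m∣n⇒∣m+n (β∈Q₁ j) (∣⇒∣*α i j (∣m⇒∣-m (ev-InQ₁ β∈Q₁ i)))

  act-InQ₁ : ∀ w {β} → InQ₁ β → InQ₁ (act D w β)
  act-InQ₁ []      β∈Q₁ = β∈Q₁
  act-InQ₁ (i ∷ w) β∈Q₁ = σ-InQ₁ i (act-InQ₁ w β∈Q₁)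

  n·-InQ₁ : ∀ β → InQ₁ ((+ n) · β)
  n·-InQ₁ β j = ∣m⇒∣m*n {m = + n} (β j) (∣ᵤ⇒∣ (ord∣n ∣ normSq D (α j) ∣))

  GenQ'⇒InQ₁ : ∀ {γ} → GenQ' D n γ → InQ₁ γ
  GenQ'⇒InQ₁ (β , inj₁ ((w , i , wα≈β) , γ≈mβ)) = InQ₁-cong (λ j → sym (γ≈mβ j))
    (InQ₁-cong (λ j → cong₂ (λ a b → + a * b) m≡m (wα≈β j))
      (InQ₁-cong (act-· D w (+ m D n i) (α i)) (act-InQ₁ w (GenQ₁⇒InQ₁ (i , λ j → refl)))))
    where
    m≡m : m D n i ≡ mRe D n β
    m≡m = cong (λ t → ord ∣ t ∣) (trans (sym (normSq-act D w (α i))) (normSq-cong D wα≈β))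
  GenQ'⇒InQ₁ (β , inj₂ (_ , γ≈nβ)) = InQ₁-cong (λ j → sym (γ≈nβ j)) (n·-InQ₁ β)

  GenQ₁⇒GenQ' : ∀ {γ} → GenQ₁ D n γ → GenQ' D n γ
  GenQ₁⇒GenQ' (i , γ≈mα) = α i , inj₁ (([] , i , λ j → refl) , γ≈mα)

mainTheorem1 : ∀ {r} (D : SymGCM r) (n : ℕ) .{{_ : NonZero n}} →
    let open SymGCM D in
    -- (1)  2 m(αᵢ)(αᵢ,αⱼ) / (m(αⱼ)(αⱼ,αⱼ)) ∈ ℤ   (note 2(αᵢ,αⱼ) = B2 i j)
    (∀ i j → ∃[ z ] z * (+ m D n j * normSq D (α j)) ≡ + m D n i * B2 i j)
    -- (2)  Q₁ is W-invariant, and Q' = Q₁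
    × (∀ (w : List (Fin r)) β → Span (GenQ₁ D n) β → Span (GenQ₁ D n) (act D w β))
    × (∀ β → Span (GenQ' D n) β ⇔ Span (GenQ₁ D n) β)
    -- (3)  β(hᵢ) ∈ m(αᵢ)ℤ for β ∈ Q'
    × (∀ β → Span (GenQ' D n) β → ∀ i → ∃[ z ] ev D β i ≡ z * + m D n i)
mainTheorem1 D n =
    (λ i j → let divides z eq = m*normSq∣m*B2 D n i j in z , sym eq)
  , (λ w β β∈Q₁ → InQ₁⇒Span D n (act-InQ₁ D n w (Span⇒InQ₁ D n (GenQ₁⇒InQ₁ D n) β∈Q₁)))
  , (λ β → mk⇔ (λ β∈Q' → InQ₁⇒Span D n (Span⇒InQ₁ D n (GenQ'⇒InQ₁ D n) β∈Q'))
               (λ (L , gens , β≈L) → L , All.map (GenQ₁⇒GenQ' D n) gens , β≈L))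
  , (λ β β∈Q' i → let divides z eq = ev-InQ₁ D n (Span⇒InQ₁ D n (GenQ'⇒InQ₁ D n) β∈Q') i in z , eq)
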